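{- The logic $\mathsf{LCA}$ is sound and complete for the class of all models: for every $\varphi\in\mathcal{L}$, $\varphi$ is a theorem of $\mathsf{LCA}$ if and only if $\models\varphi$.
   Context: Fix a countably infinite set $\mathit{Atm}$ of atomic propositions and a finite set of agents $\mathit{Agt}=\{1,\dots,n\}$. For every $i\in\mathit{Agt}$, $\mathit{Atm}$ contains two distinguished atoms $\mathit{good}_i$ and $\mathit{bad}_i$. The language $\mathcal{L}_0$ is $\alpha ::= p \mid \neg\alpha \mid \alpha\wedge\alpha \mid \triangle_i\alpha$ with $p\in\mathit{Atm}$, $i\in\mathit{Agt}$; $\top,\bot,\vee,\rightarrow,\leftrightarrow$ are the usual abbreviations. A state is a tuple $S=((B_i)_{i\in\mathit{Agt}},V)$ with $B_i\subseteq\mathcal{L}_0$ and $V\subseteq\mathit{Atm}$; $\mathbf{S}$ is the set of all states. For $\alpha\in\mathcal{L}_0$: $S\models p$ iff $p\in V$; Boolean connectives as usual; $S\models\triangle_i\alpha$ iff $\alpha\in B_i$. Define $\mathit{Des}_i(S)=\{\alpha : (\alpha\rightarrow\mathit{good}_i)\in B_i\}$, $\mathit{Undes}_i(S)=\{\alpha : (\alpha\rightarrow\mathit{bad}_i)\in B_i\}$. Relations on $\mathbf{S}$: $S\,\mathcal{E}_i\,S'$ iff $S'\models\alpha$ for all $\alpha\in B_i$; $S\,\mathcal{A}_i\,S'$ iff some $\alpha\in\mathit{Des}_i(S)$ has $S'\models\alpha$; $S\,\mathcal{R}_i\,S'$ iff some $\alpha\in\mathit{Undes}_i(S)$ has $S'\models\alpha$.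 A model is a pair $(S,U)$ with $S\in U\subseteq\mathbf{S}$. The language $\mathcal{L}$ is $\varphi ::= \alpha \mid \neg\varphi\mid\varphi\wedge\varphi\mid \Box_i\varphi \mid \mathsf{A}_i\varphi\mid\mathsf{R}_i\varphi\mid\mathsf{A}^{\mathsf{real}}_i\varphi\mid\mathsf{R}^{\mathsf{real}}_i\varphi$ ($\alpha\in\mathcal{L}_0$). Semantics: $(S,U)\models\alpha$ iff $S\models\alpha$; Boolean as usual; $(S,U)\models\Box_i\varphi$ iff all $S'\in U$ with $S\,\mathcal{E}_i\,S'$ satisfy $(S',U)\models\varphi$; $(S,U)\models\mathsf{A}_i\varphi$ iff every $S'\in U$ with $(S',U)\models\varphi$ has $S\,\mathcal{A}_i\,S'$; $(S,U)\models\mathsf{R}_i\varphi$ iff every $S'\in U$ with $(S',U)\models\varphi$ has $S\,\mathcal{R}_i\,S'$; $(S,U)\models\mathsf{A}^{\mathsf{real}}_i\varphi$ iff every $S'\in U$ with $(S',U)\models\varphi$ and $S\,\mathcal{E}_i\,S'$ has $S\,\mathcal{A}_i\,S'$; $(S,U)\models\mathsf{R}^{\mathsf{real}}_i\varphi$ iff every $S'\in U$ with $(S',U)\models\varphi$ and $S\,\mathcal{E}_i\,S'$ has $S\,\mathcal{R}_i\,S'$. $\models\varphi$ means $\varphi$ holds in every model. The logic $\mathsf{LCA}$ is the extension of classical propositional logic (over $\mathcal{L}$) by the following axioms and rules, for all $i\in\mathit{Agt}$, $\varphi,\psi\in\mathcal{L}$, $\alpha\in\mathcal{L}_0$, and $\circledcirc\in\{\mathsf{A}_i,\mathsf{R}_i,\mathsf{A}^{\mathsf{real}}_i,\mathsf{R}^{\mathsf{real}}_i\}$: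 (A1) $(\Box_i\varphi\wedge\Box_i(\varphi\rightarrow\psi))\rightarrow\Box_i\psi$; (A2) $(\circledcirc\varphi\wedge\circledcirc(\neg\varphi\wedge\psi))\rightarrow\circledcirc\psi$; (A3) $\triangle_i\alpha\rightarrow\Box_i\alpha$; (A4) $\triangle_i(\alpha\rightarrow\mathit{good}_i)\rightarrow\mathsf{A}_i\alpha$; (A5) $\triangle_i(\alpha\rightarrow\mathit{bad}_i)\rightarrow\mathsf{R}_i\alpha$; (A6) $\mathsf{A}_i\varphi\rightarrow\mathsf{A}^{\mathsf{real}}_i\varphi$; (A7) $\mathsf{R}_i\varphi\rightarrow\mathsf{R}^{\mathsf{real}}_i\varphi$; (A8) $\Box_i\varphi\rightarrow\mathsf{A}^{\mathsf{real}}_i\neg\varphi$; (A9) $\Box_i\varphi\rightarrow\mathsf{R}^{\mathsf{real}}_i\neg\varphi$; (A10) $\mathsf{A}^{\mathsf{real}}_i\varphi\rightarrow\Box_i(\varphi\rightarrow\mathit{good}_i)$; (A11) $\mathsf{R}^{\mathsf{real}}_i\varphi\rightarrow\Box_i(\varphi\rightarrow\mathit{bad}_i)$; (R1) from $\varphi$ infer $\Box_i\varphi$; (R2) from $\varphi$ infer $\circledcirc\neg\varphi$; (R3) from $\varphi\leftrightarrow\psi$ infer $\circledcirc\varphi\leftrightarrow\circledcirc\psi$. -}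

module Defs where

open import Level using (Level; Lift; lift; 0ℓ) renaming (suc to lsuc)
open import Data.Nat using (ℕ)
open import Data.Fin using (Fin)
open import Data.Bool using (Bool; true; false; not; _∧_)
open import Data.Product using (Σ; _×_; _,_)
open import Data.Empty using (⊥)
open import Relation.Binary.PropositionalEquality using (_≡_)

data Atm (n : ℕ) : Set where
  good : Fin n → Atm n
  bad  : Fin n → Atm n
  prop : ℕ → Atm n

data Form0 (n : ℕ) : Set where
  atom₀ : Atm n → Form0 n
  ¬₀_   : Form0 n → Form0 n
  _∧₀_  : Form0 n → Form0 n → Form0 n
  △     : Fin n → Form0 n → Form0 n

_⇒₀_ : ∀ {n} → Form0 n → Form0 n → Form0 n
α ⇒₀ β = ¬₀ (α ∧₀ (¬₀ β))

data Op : Set where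
  opA opR opAreal opRreal : Op

-- The language L.  The L0-fragment is embedded via the constructors
-- atom, ¬', ∧', tri (see ι below), so L0 ⊆ L.
data Form (n : ℕ) : Set where
  atom : Atm n → Form n
  tri  : Fin n → Form0 n → Form n
  ¬'_  : Form n → Form n
  _∧'_ : Form n → Form n → Form n
  □    : Fin n → Form n → Form n
  mod  : Op → Fin n → Form n → Form n

ι : ∀ {n} → Form0 n → Form n
ι (atom₀ p) = atom p
ι (¬₀ α)    = ¬' ι α
ι (α ∧₀ β)  = ι α ∧' ι β
ι (△ i α)   = tri i α

module _ {n : ℕ} where

  _⇒_ : Form n → Form n → Form n
  φ ⇒ ψ = ¬' (φ ∧' (¬' ψ))

  _⇔'_ : Form n → Form n → Form n
  φ ⇔' ψ = (φ ⇒ ψ) ∧' (ψ ⇒ φ)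

  A Rm Areal Rreal : Fin n → Form n → Form n
  A     = mod opA
  Rm    = mod opR
  Areal = mod opAreal
  Rreal = mod opRreal

  -- Classical propositional logic over L: a tautology is a formula that
  -- is true under every Boolean valuation of its non-Boolean
  -- (i.e. propositionally atomic) subformulas.

  evalB : (Form n → Bool) → Form n → Bool
  evalB v (¬' φ)   = not (evalB v φ)
  evalB v (φ ∧' ψ) = evalB v φ ∧ evalB v ψ
  evalB v φ        = v φ

  Tautology : Form n → Set
  Tautology φ = (v : Form n → Bool) → evalB v φ ≡ true

  data ⊢_ : Form n → Set where
    taut : ∀ {φ} → Tautology φ → ⊢ φ
    mp   : ∀ {φ ψ} → ⊢ φ → ⊢ (φ ⇒ ψ) → ⊢ ψ
    A1   : ∀ i φ ψ → ⊢ ((□ i φ ∧' □ i (φ ⇒ ψ)) ⇒ □ i ψ)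
    A2   : ∀ o i φ ψ → ⊢ ((mod o i φ ∧' mod o i ((¬' φ) ∧' ψ)) ⇒ mod o i ψ)
    A3   : ∀ i α → ⊢ (tri i α ⇒ □ i (ι α))
    A4   : ∀ i α → ⊢ (tri i (α ⇒₀ atom₀ (good i)) ⇒ A i (ι α))
    A5   : ∀ i α → ⊢ (tri i (α ⇒₀ atom₀ (bad i)) ⇒ Rm i (ι α))
    A6   : ∀ i φ → ⊢ (A i φ ⇒ Areal i φ)
    A7   : ∀ i φ → ⊢ (Rm i φ ⇒ Rreal i φ)
    A8   : ∀ i φ → ⊢ (□ i φ ⇒ Areal i (¬' φ))
    A9   : ∀ i φ → ⊢ (□ i φ ⇒ Rreal i (¬' φ))
    A10  : ∀ i φ → ⊢ (Areal i φ ⇒ □ i (φ ⇒ atom (good i)))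
    A11  : ∀ i φ → ⊢ (Rreal i φ ⇒ □ i (φ ⇒ atom (bad i)))
    R1   : ∀ i {φ} → ⊢ φ → ⊢ □ i φ
    R2   : ∀ o i {φ} → ⊢ φ → ⊢ mod o i (¬' φ)
    R3   : ∀ o i {φ ψ} → ⊢ (φ ⇔' ψ) → ⊢ (mod o i φ ⇔' mod o i ψ)

  record State : Set₁ where
    field
      B : Fin n → Form0 n → Set
      V : Atm n → Set
  open State public

  _⊨₀_ : State → Form0 n → Set
  S ⊨₀ atom₀ p = V S p
  S ⊨₀ (¬₀ α)   = S ⊨₀ α → ⊥
  S ⊨₀ (α ∧₀ β) = (S ⊨₀ α) × (S ⊨₀ β)
  S ⊨₀ △ i α    = B S i α

  Des Undes : Fin n → State → Form0 n → Set
  Des   i S α = B S i (α ⇒₀ atom₀ (good i))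
  Undes i S α = B S i (α ⇒₀ atom₀ (bad i))

  ℰ 𝒜 ℛ : Fin n → State → State → Set
  ℰ i S S' = ∀ α → B S i α → S' ⊨₀ α
  𝒜 i S S' = Σ (Form0 n) λ α → Des i S α × (S' ⊨₀ α)
  ℛ i S S' = Σ (Form0 n) λ α → Undes i S α × (S' ⊨₀ α)

  Sat : (State → Set₁) → State → Form n → Set₁
  Sat U S (atom p)  = Lift (lsuc 0ℓ) (V S p)
  Sat U S (tri i α) = Lift (lsuc 0ℓ) (B S i α)
  Sat U S (¬' φ)    = Sat U S φ → Lift (lsuc 0ℓ) ⊥
  Sat U S (φ ∧' ψ)  = Sat U S φ × Sat U S ψ
  Sat U S (□ i φ)   = ∀ S' → U S' → ℰ i S S' → Sat U S' φ
  Sat U S (mod opA i φ)     = ∀ S' → U S' → Sat U S' φ → 𝒜 i S S'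
  Sat U S (mod opR i φ)     = ∀ S' → U S' → Sat U S' φ → ℛ i S S'
  Sat U S (mod opAreal i φ) = ∀ S' → U S' → Sat U S' φ → ℰ i S S' → 𝒜 i S S'
  Sat U S (mod opRreal i φ) = ∀ S' → U S' → Sat U S' φ → ℰ i S S' → ℛ i S S'

  -- a model is a pair (S,U) with S ∈ U ⊆ 𝐒;  ⊨ φ : φ true in every model
  ⊨_ : Form n → Set₂
  ⊨ φ = (U : State → Set₁) (S : State) → U S → Sat U S φ

{-# OPTIONS --safe #-}
module Submission where

-- Soundness is an induction on derivations; excluded middle supplies the classical reasoning about
-- the Set₁-valued satisfaction relation.
--
-- For completeness, a non-theorem φ is refuted in a canonical model whose states are indexed by a
-- maximal consistent set w and a flag h. Since ℰᵢ, 𝒜ᵢ and ℛᵢ are read off belief bases, w is written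
-- into atoms that do not occur in φ: ⌜χ⌝ is true iff χ ∈ w, the marker atom is true iff h, and
-- besides the α over the atoms of φ with △ᵢα ∈ w, agent i believes ¬marker, ⌜χ⌝ for □ᵢχ ∈ w,
-- ⌜χ⌝ → goodᵢ for Aᵢχ ∈ w and (⌜χ⌝ ∧ ¬marker) → goodᵢ for Aʳᵉᵃˡᵢχ ∈ w (likewise badᵢ for R).
-- Then ℰᵢ leads from (w, h) exactly to the unmarked (v, false) with {χ | □ᵢχ ∈ w} ⊆ v, and 𝒜ᵢ
-- exactly to the (v, h′) where v contains some χ with Aᵢχ ∈ w, or with Aʳᵉᵃˡᵢχ ∈ w if h′ is false.
-- The witnesses for the truth lemma are Lindenbaum extensions of the theories {a | □ᵢa ∈ w} and
-- {a | ⊚¬a ∈ w}; by A8/A9 the latter contains the former when ⊚ is realistic. Lindenbaum's lemma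
-- enumerates formulas through an injection into ℕ.

open import Defs
open import Level using (Level; Lift; lift; lower; 0ℓ) renaming (suc to lsuc)
open import Axiom.ExcludedMiddle using (ExcludedMiddle)
open import Axiom.DoubleNegationElimination using (em⇒dne)
open import Data.Bool using (Bool; true; false; not; _∧_; T)
open import Data.Bool.Properties using (T-≡; T-∧)
open import Data.Empty using (⊥; ⊥-elim)
open import Data.Fin using (Fin; zero; suc; toℕ; fromℕ<)
open import Data.Fin.Properties using (toℕ<n; fromℕ<-toℕ)
open import Data.Maybe as Maybe using (Maybe; just; nothing)
open import Data.Maybe.Properties using (just-injective)
open import Data.Nat using (ℕ; zero; suc; _+_; _⊔_; _≤_; _<_; _≤′_; ≤′-refl; ≤′-step)
open import Data.Nat.Properties
  using (_<?_; ≤-refl; ≤-trans; m≤m⊔n; m≤n⊔m; ≤⇒≤′; suc-injective; +-cancelˡ-≡; n≮n; m+n≮m; m+1+n≢m)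
open import Data.Nat.Binary as ℕᵇ using (ℕᵇ; zero; 2[1+_]; 1+[2_])
open import Data.Nat.Binary.Properties using (toℕ-injective; 2[1+_]-injective; 1+[2_]-injective)
open import Data.Product using (Σ; Σ-syntax; ∃-syntax; ∃₂; _×_; _,_; proj₁; proj₂)
open import Data.Product.Function.NonDependent.Propositional using (_×-⇔_)
open import Data.Sum as Sum using (_⊎_; inj₁; inj₂; [_,_]′)
open import Data.Unit using (⊤; tt)
open import Data.Vec as Vec using (Vec; []; _∷_; lookup)
open import Data.Vec.Properties using (lookup-map)
open import Function using (_∘_; id; case_of_)
open import Function.Bundles using (Equivalence; _⇔_; mk⇔)
open import Function.Properties.Equivalence using () renaming (trans to ⇔-trans; sym to ⇔-sym)
open import Function.Related.TypeIsomorphisms using (¬-cong-⇔; →-cong-⇔)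
open import Relation.Binary.PropositionalEquality
  using (_≡_; refl; sym; trans; cong; cong₂; subst; module ≡-Reasoning)
open import Relation.Nullary using (¬_; Dec; yes; no)
open import Relation.Nullary.Decidable using (isYes; toWitness; fromWitness; toSum; decidable-stable)
open import Relation.Unary using (Pred; _⊆_; _∪_; ｛_｝)

open Equivalence using (to; from)

private variable
  k m n N : ℕ
  h h′ : Bool
  i : Fin n
  o o′ : Op
  ℓ p : Atm n
  α : Form0 n
  a b c x y φ ψ χ : Form n
  Γ Δ F : Pred (Form n) 0ℓ

-- Propositional tautologies

infix  7 ~_
infixr 6 _&_
infixr 5 _⊃_
infix  4 _⟷_

data Schema (k : ℕ) : Set where
  var : Fin k → Schema k
  ~_  : Schema k → Schema k
  _&_ : Schema k → Schema k → Schema k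

_⊃_ _⟷_ : Schema k → Schema k → Schema k
s ⊃ t = ~ (s & ~ t)
s ⟷ t = (s ⊃ t) & (t ⊃ s)

x₀ : Schema (suc k)
x₀ = var zero

x₁ : Schema (suc (suc k))
x₁ = var (suc zero)

x₂ : Schema (suc (suc (suc k)))
x₂ = var (suc (suc zero))

⟦_⟧ : Schema k → Vec Bool k → Bool
⟦ var v ⟧ ρ = lookup ρ v
⟦ ~ s ⟧   ρ = not (⟦ s ⟧ ρ)
⟦ s & t ⟧ ρ = ⟦ s ⟧ ρ ∧ ⟦ t ⟧ ρ

allTrue : ∀ k → (Vec Bool k → Bool) → Bool
allTrue zero    f = f []
allTrue (suc k) f = allTrue k (f ∘ (true ∷_)) ∧ allTrue k (f ∘ (false ∷_))

allTrue-sound : ∀ k f → T (allTrue k f) → ∀ ρ → T (f ρ)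
allTrue-sound zero    f valid []          = valid
allTrue-sound (suc k) f valid (true ∷ ρ)  = allTrue-sound k _ (proj₁ (to T-∧ valid)) ρ
allTrue-sound (suc k) f valid (false ∷ ρ) = allTrue-sound k _ (proj₂ (to T-∧ valid)) ρ

_⟨_⟩ : Schema k → Vec (Form n) k → Form n
var v ⟨ σ ⟩   = lookup σ v
(~ s) ⟨ σ ⟩   = ¬' (s ⟨ σ ⟩)
(s & t) ⟨ σ ⟩ = (s ⟨ σ ⟩) ∧' (t ⟨ σ ⟩)

evalB-⟨⟩ : ∀ val (s : Schema k) (σ : Vec (Form n) k) →
           evalB val (s ⟨ σ ⟩) ≡ ⟦ s ⟧ (Vec.map (evalB val) σ)
evalB-⟨⟩ val (var v) σ = sym (lookup-map v (evalB val) σ)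
evalB-⟨⟩ val (~ s)   σ = cong not (evalB-⟨⟩ val s σ)
evalB-⟨⟩ val (s & t) σ = cong₂ _∧_ (evalB-⟨⟩ val s σ) (evalB-⟨⟩ val t σ)

tautology : (s : Schema k) {_ : T (allTrue k ⟦ s ⟧)} (σ : Vec (Form n) k) → ⊢ (s ⟨ σ ⟩)
tautology {k} s {valid} σ = taut λ val →
  trans (evalB-⟨⟩ val s σ) (to T-≡ (allTrue-sound k ⟦ s ⟧ valid (Vec.map (evalB val) σ)))

falsum : Form n
falsum = atom (prop 0) ∧' (¬' atom (prop 0))

⊢-mod-refutable : ∀ o i → ⊢ (¬' a) → ⊢ mod o i a
⊢-mod-refutable {a = a} o i ⊢¬a = mp (R2 o i ⊢¬a) (mp (R3 o i (tautology (~ ~ x₀ ⟷ x₀) (a ∷ [])))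
  (tautology ((x₀ ⊃ x₁) & (x₁ ⊃ x₀) ⊃ x₀ ⊃ x₁) (mod o i (¬' ¬' a) ∷ mod o i a ∷ [])))

-- A2 turns ⊚x into ⊚y, since ⊚(¬x ∧ y) holds vacuously by R2 and R3.
mod-antitone : ∀ o i → ⊢ (y ⇒ x) → ⊢ (mod o i x ⇒ mod o i y)
mod-antitone {y = y} {x = x} o i y⇒x =
  mp (⊢-mod-refutable o i (mp y⇒x (tautology ((x₁ ⊃ x₀) ⊃ ~ (~ x₀ & x₁)) (x ∷ y ∷ []))))
     (mp (A2 o i x y) (tautology ((x₀ & x₁ ⊃ x₂) ⊃ x₁ ⊃ x₀ ⊃ x₂)
                                 (mod o i x ∷ mod o i ((¬' x) ∧' y) ∷ mod o i y ∷ [])))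

infix 3 _⊩_

data _⊩_ (Γ : Pred (Form n) 0ℓ) : Form n → Set where
  hyp : Γ a → Γ ⊩ a
  thm : ⊢ a → Γ ⊩ a
  mp⊩ : Γ ⊩ a → Γ ⊩ (a ⇒ b) → Γ ⊩ b

Consistent : Pred (Form n) 0ℓ → Set
Consistent Γ = ¬ (Γ ⊩ falsum)

_⊩-⊢_ : Γ ⊩ a → ⊢ (a ⇒ b) → Γ ⊩ b
d ⊩-⊢ a⇒b = mp⊩ d (thm a⇒b)

⊩-mono : Γ ⊆ Δ → Γ ⊩ a → Δ ⊩ a
⊩-mono Γ⊆Δ (hyp a∈Γ) = hyp (Γ⊆Δ a∈Γ)
⊩-mono Γ⊆Δ (thm ⊢a)  = thm ⊢a
⊩-mono Γ⊆Δ (mp⊩ d e) = mp⊩ (⊩-mono Γ⊆Δ d) (⊩-mono Γ⊆Δ e)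

deduction : Γ ∪ ｛ x ｝ ⊩ b → Γ ⊩ (x ⇒ b)
deduction {x = x} (hyp {a} (inj₁ a∈Γ)) = hyp a∈Γ ⊩-⊢ tautology (x₀ ⊃ x₁ ⊃ x₀) (a ∷ x ∷ [])
deduction {x = x} (hyp (inj₂ refl))     = thm (tautology (x₀ ⊃ x₀) (x ∷ []))
deduction {x = x} (thm {a} ⊢a)          = thm (mp ⊢a (tautology (x₀ ⊃ x₁ ⊃ x₀) (a ∷ x ∷ [])))
deduction {x = x} (mp⊩ {a} {b} d e)     = mp⊩ (deduction e)
  (deduction d ⊩-⊢ tautology ((x₀ ⊃ x₁) ⊃ (x₀ ⊃ x₁ ⊃ x₂) ⊃ x₀ ⊃ x₂) (x ∷ a ∷ b ∷ []))

¬-extension-consistent : Consistent Γ → ¬ Consistent (Γ ∪ ｛ y ｝) → Consistent (Γ ∪ ｛ ¬' y ｝)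
¬-extension-consistent {y = y} Γ-consistent y-inconsistent d = y-inconsistent λ d′ → Γ-consistent
  (mp⊩ (deduction d) (deduction d′ ⊩-⊢ tautology ((x₀ ⊃ x₁) ⊃ (~ x₀ ⊃ x₁) ⊃ x₁) (y ∷ falsum ∷ [])))

record IsTheory (F : Pred (Form n) 0ℓ) : Set where
  field
    ⊢⇒∈ : ⊢ a → F a
    mp∈ : F a → F (a ⇒ b) → F b

  ⊩⇒∈ : F ⊩ a → F a
  ⊩⇒∈ (hyp a∈F) = a∈F
  ⊩⇒∈ (thm ⊢a)  = ⊢⇒∈ ⊢a
  ⊩⇒∈ (mp⊩ d e) = mp∈ (⊩⇒∈ d) (⊩⇒∈ e)

  ∈-⊢ : F a → ⊢ (a ⇒ b) → F b
  ∈-⊢ a∈F a⇒b = mp∈ a∈F (⊢⇒∈ a⇒b)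

  extension-consistent : ¬ F (x ⇒ falsum) → Consistent (F ∪ ｛ x ｝)
  extension-consistent x⇒⊥∉F d = x⇒⊥∉F (⊩⇒∈ (deduction d))

⊢-theory : IsTheory {n} ⊢_
⊢-theory = record { ⊢⇒∈ = id ; mp∈ = mp }

-- Maximal consistent sets

record MCS (n : ℕ) : Set₁ where
  field
    Member     : Pred (Form n) 0ℓ
    consistent : Consistent Member
    decisive   : ∀ a → Member a ⊎ Member (¬' a)

open MCS using (Member)

infix 4 _∈_
_∈_ : Form n → MCS n → Set
a ∈ w = Member w a

private variable
  w v : MCS n

Access : Fin n → MCS n → MCS n → Set
Access i w v = ∀ {χ} → □ i χ ∈ w → χ ∈ v

module _ {n : ℕ} (w : MCS n) where
  open MCS w using (consistent; decisive)

  ⊩⇒∈ : Member w ⊩ a → a ∈ w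
  ⊩⇒∈ {a} d with decisive a
  ... | inj₁ a∈w  = a∈w
  ... | inj₂ ¬a∈w =
    ⊥-elim (consistent (mp⊩ d (hyp ¬a∈w ⊩-⊢ tautology (~ x₀ ⊃ x₀ ⊃ x₁) (a ∷ falsum ∷ []))))

  ∈-theory : IsTheory (Member w)
  ∈-theory = record { ⊢⇒∈ = ⊩⇒∈ ∘ thm ; mp∈ = λ a∈w a⇒b∈w → ⊩⇒∈ (mp⊩ (hyp a∈w) (hyp a⇒b∈w)) }

  open IsTheory ∈-theory public using (⊢⇒∈; mp∈; ∈-⊢)

  ∈-⊢₂ : a ∈ w → b ∈ w → ⊢ ((a ∧' b) ⇒ c) → c ∈ w
  ∈-⊢₂ {a} {b} {c} a∈w b∈w a∧b⇒c = mp∈ b∈w (mp∈ a∈w (⊢⇒∈ (mp a∧b⇒c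
    (tautology ((x₀ & x₁ ⊃ x₂) ⊃ x₀ ⊃ x₁ ⊃ x₂) (a ∷ b ∷ c ∷ [])))))

  ¬-∈ : ¬' a ∈ w ⇔ (¬ a ∈ w)
  ¬-∈ {a} = mk⇔
    (λ ¬a∈w a∈w → consistent (mp⊩ (hyp a∈w) (hyp ¬a∈w ⊩-⊢ tautology (~ x₀ ⊃ x₀ ⊃ x₁) (a ∷ falsum ∷ []))))
    (λ a∉w → [ ⊥-elim ∘ a∉w , id ]′ (decisive a))

  ∧-∈ : (a ∈ w × b ∈ w) ⇔ (a ∧' b) ∈ w
  ∧-∈ {a} {b} = mk⇔
    (λ (a∈w , b∈w) → ∈-⊢₂ a∈w b∈w (tautology (x₀ & x₁ ⊃ x₀ & x₁) (a ∷ b ∷ [])))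
    (λ a∧b∈w → ∈-⊢ a∧b∈w (tautology (x₀ & x₁ ⊃ x₀) (a ∷ b ∷ [])) ,
               ∈-⊢ a∧b∈w (tautology (x₀ & x₁ ⊃ x₁) (a ∷ b ∷ [])))

  ∈-stable : ¬ ¬ a ∈ w → a ∈ w
  ∈-stable {a} ¬¬a∈w = [ id , ⊥-elim ∘ ¬¬a∈w ∘ to ¬-∈ ]′ (decisive a)

  □-theory : ∀ i → IsTheory (λ a → □ i a ∈ w)
  □-theory i = record
    { ⊢⇒∈ = ⊢⇒∈ ∘ R1 i
    ; mp∈ = λ {a} {b} □a∈w □a⇒b∈w → ∈-⊢₂ □a∈w □a⇒b∈w (A1 i a b)
    }

  mod¬-theory : ∀ o i → IsTheory (λ a → mod o i (¬' a) ∈ w)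
  mod¬-theory o i = record
    { ⊢⇒∈ = ⊢⇒∈ ∘ R2 o i
    ; mp∈ = λ {a} {b} ⊚¬a∈w ⊚¬a⇒b∈w → ∈-⊢₂ ⊚¬a∈w
        (∈-⊢ ⊚¬a⇒b∈w (mod-antitone o i (tautology (~ ~ x₀ & ~ x₁ ⊃ ~ (x₀ ⊃ x₁)) (a ∷ b ∷ []))))
        (A2 o i (¬' a) (¬' b))
    }

mod-excludes : ∀ (w v : MCS n) → (λ a → mod o i (¬' a) ∈ w) ⊆ Member v → mod o i χ ∈ w → ¬ χ ∈ v
mod-excludes {o = o} {i} {χ} w v ⊆v ⊚χ∈w =
  to (¬-∈ v) (⊆v (∈-⊢ w ⊚χ∈w (mod-antitone o i (tautology (~ ~ x₀ ⊃ x₀) (χ ∷ [])))))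

data Valence (i : Fin n) : Op → Op → Atm n → Set where
  attraction : Valence i opA opAreal (good i)
  repulsion  : Valence i opR opRreal (bad i)

tri⇒plain : Valence i o o′ ℓ → ∀ α → ⊢ (tri i (α ⇒₀ atom₀ ℓ) ⇒ mod o i (ι α))
tri⇒plain attraction = A4 _
tri⇒plain repulsion  = A5 _

plain⇒real : Valence i o o′ ℓ → ∀ φ → ⊢ (mod o i φ ⇒ mod o′ i φ)
plain⇒real attraction = A6 _
plain⇒real repulsion  = A7 _

□⇒real¬ : Valence i o o′ ℓ → ∀ φ → ⊢ (□ i φ ⇒ mod o′ i (¬' φ))
□⇒real¬ attraction = A8 _
□⇒real¬ repulsion  = A9 _

real⇒□ : Valence i o o′ ℓ → ∀ φ → ⊢ (mod o′ i φ ⇒ □ i (φ ⇒ atom ℓ))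
real⇒□ attraction = A10 _
real⇒□ repulsion  = A11 _

□-cone⊆real-cone : ∀ (w v : MCS n) → Valence i o o′ ℓ →
                   (λ a → mod o′ i (¬' a) ∈ w) ⊆ Member v → Access i w v
□-cone⊆real-cone w v val ⊆v □χ∈w = ⊆v (∈-⊢ w □χ∈w (□⇒real¬ val _))

-- Countability of the language

data Tree : Set where
  leaf : ℕ → Tree
  node : Tree → Tree → Tree

decodeFin : ℕ → Maybe (Fin n)
decodeFin {n} k with k <? n
... | yes k<n = just (fromℕ< k<n)
... | no _    = nothing

decodeFin-toℕ : ∀ (i : Fin n) → decodeFin (toℕ i) ≡ just i
decodeFin-toℕ {n} i with toℕ i <? n
... | yes i<n = cong just (fromℕ<-toℕ i i<n)
... | no i≮n  = ⊥-elim (i≮n (toℕ<n i))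

encodeOp : Op → ℕ
encodeOp opA     = 0
encodeOp opR     = 1
encodeOp opAreal = 2
encodeOp opRreal = 3

decodeOp : ℕ → Maybe Op
decodeOp 0 = just opA
decodeOp 1 = just opR
decodeOp 2 = just opAreal
decodeOp 3 = just opRreal
decodeOp _ = nothing

decodeOp-encodeOp : ∀ o → decodeOp (encodeOp o) ≡ just o
decodeOp-encodeOp opA     = refl
decodeOp-encodeOp opR     = refl
decodeOp-encodeOp opAreal = refl
decodeOp-encodeOp opRreal = refl

encodeAtm : Atm n → Tree
encodeAtm (good i) = node (leaf 0) (leaf (toℕ i))
encodeAtm (bad i)  = node (leaf 1) (leaf (toℕ i))
encodeAtm (prop k) = node (leaf 2) (leaf k)

decodeAtm : Tree → Maybe (Atm n)
decodeAtm (node (leaf 0) (leaf i)) = Maybe.map good (decodeFin i)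
decodeAtm (node (leaf 1) (leaf i)) = Maybe.map bad (decodeFin i)
decodeAtm (node (leaf 2) (leaf k)) = just (prop k)
decodeAtm _                        = nothing

decodeAtm-encodeAtm : ∀ (p : Atm n) → decodeAtm (encodeAtm p) ≡ just p
decodeAtm-encodeAtm (good i) = cong (Maybe.map good) (decodeFin-toℕ i)
decodeAtm-encodeAtm (bad i)  = cong (Maybe.map bad) (decodeFin-toℕ i)
decodeAtm-encodeAtm (prop k) = refl

encode₀ : Form0 n → Tree
encode₀ (atom₀ p) = node (leaf 0) (encodeAtm p)
encode₀ (¬₀ α)    = node (leaf 1) (encode₀ α)
encode₀ (α ∧₀ β)  = node (leaf 2) (node (encode₀ α) (encode₀ β))
encode₀ (△ i α)   = node (leaf 3) (node (leaf (toℕ i)) (encode₀ α))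

decode₀ : Tree → Maybe (Form0 n)
decode₀ (node (leaf 0) t)                 = Maybe.map atom₀ (decodeAtm t)
decode₀ (node (leaf 1) t)                 = Maybe.map ¬₀_ (decode₀ t)
decode₀ (node (leaf 2) (node s t))        = Maybe.zipWith _∧₀_ (decode₀ s) (decode₀ t)
decode₀ (node (leaf 3) (node (leaf i) t)) = Maybe.zipWith △ (decodeFin i) (decode₀ t)
decode₀ _                                 = nothing

decode₀-encode₀ : ∀ (α : Form0 n) → decode₀ (encode₀ α) ≡ just α
decode₀-encode₀ (atom₀ p) = cong (Maybe.map atom₀) (decodeAtm-encodeAtm p)
decode₀-encode₀ (¬₀ α)    = cong (Maybe.map ¬₀_) (decode₀-encode₀ α)
decode₀-encode₀ (α ∧₀ β)  = cong₂ (Maybe.zipWith _∧₀_) (decode₀-encode₀ α) (decode₀-encode₀ β)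
decode₀-encode₀ (△ i α)   = cong₂ (Maybe.zipWith △) (decodeFin-toℕ i) (decode₀-encode₀ α)

encode : Form n → Tree
encode (atom p)    = node (leaf 0) (encodeAtm p)
encode (tri i α)   = node (leaf 1) (node (leaf (toℕ i)) (encode₀ α))
encode (¬' φ)      = node (leaf 2) (encode φ)
encode (φ ∧' ψ)    = node (leaf 3) (node (encode φ) (encode ψ))
encode (□ i φ)     = node (leaf 4) (node (leaf (toℕ i)) (encode φ))
encode (mod o i φ) = node (leaf 5) (node (leaf (encodeOp o)) (node (leaf (toℕ i)) (encode φ)))

decode : Tree → Maybe (Form n)
decode (node (leaf 0) t)                 = Maybe.map atom (decodeAtm t)
decode (node (leaf 1) (node (leaf i) t)) = Maybe.zipWith tri (decodeFin i) (decode₀ t)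
decode (node (leaf 2) t)                 = Maybe.map ¬'_ (decode t)
decode (node (leaf 3) (node s t))        = Maybe.zipWith _∧'_ (decode s) (decode t)
decode (node (leaf 4) (node (leaf i) t)) = Maybe.zipWith □ (decodeFin i) (decode t)
decode (node (leaf 5) (node (leaf o) (node (leaf i) t))) =
  Maybe.ap (Maybe.zipWith mod (decodeOp o) (decodeFin i)) (decode t)
decode _ = nothing

decode-encode : ∀ (φ : Form n) → decode (encode φ) ≡ just φ
decode-encode (atom p)    = cong (Maybe.map atom) (decodeAtm-encodeAtm p)
decode-encode (tri i α)   = cong₂ (Maybe.zipWith tri) (decodeFin-toℕ i) (decode₀-encode₀ α)
decode-encode (¬' φ)      = cong (Maybe.map ¬'_) (decode-encode φ)
decode-encode (φ ∧' ψ)    = cong₂ (Maybe.zipWith _∧'_) (decode-encode φ) (decode-encode ψ)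
decode-encode (□ i φ)     = cong₂ (Maybe.zipWith □) (decodeFin-toℕ i) (decode-encode φ)
decode-encode (mod o i φ) =
  cong₂ Maybe.ap (cong₂ (Maybe.zipWith mod) (decodeOp-encodeOp o) (decodeFin-toℕ i)) (decode-encode φ)

-- A prefix code in which 2[1+_] and 1+[2_] are the bits 0 and 1: a leaf is 0 followed by its
-- label in unary, a node is 1 followed by its two subtrees.
unary : ℕ → ℕᵇ → ℕᵇ
unary zero    r = 2[1+ r ]
unary (suc k) r = 1+[2 unary k r ]

serialise : Tree → ℕᵇ → ℕᵇ
serialise (leaf k)   r = 2[1+ unary k r ]
serialise (node s t) r = 1+[2 serialise s (serialise t r) ]

unary-injective : ∀ k k′ {r r′} → unary k r ≡ unary k′ r′ → k ≡ k′ × r ≡ r′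
unary-injective zero    zero     e = refl , 2[1+_]-injective e
unary-injective (suc k) (suc k′) e with unary-injective k k′ (1+[2_]-injective e)
... | refl , r≡r′ = refl , r≡r′
unary-injective zero    (suc _) ()
unary-injective (suc _) zero    ()

serialise-injective : ∀ s t {r r′} → serialise s r ≡ serialise t r′ → s ≡ t × r ≡ r′
serialise-injective (leaf k) (leaf k′) e with unary-injective k k′ (2[1+_]-injective e)
... | refl , r≡r′ = refl , r≡r′
serialise-injective (node s₁ s₂) (node t₁ t₂) e with serialise-injective s₁ t₁ (1+[2_]-injective e)
... | refl , e′ with serialise-injective s₂ t₂ e′
... | refl , r≡r′ = refl , r≡r′
serialise-injective (leaf _)   (node _ _) ()
serialise-injective (node _ _) (leaf _)   ()

code : Form n → ℕ
code φ = ℕᵇ.toℕ (serialise (encode φ) zero)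

code-injective : code φ ≡ code ψ → φ ≡ ψ
code-injective {φ = φ} {ψ} e = just-injective (begin
  just φ            ≡⟨ sym (decode-encode φ) ⟩
  decode (encode φ) ≡⟨ cong decode (proj₁ (serialise-injective (encode φ) (encode ψ) (toℕ-injective e))) ⟩
  decode (encode ψ) ≡⟨ decode-encode ψ ⟩
  just ψ            ∎)
  where open ≡-Reasoning

AtomBelow : ℕ → Atm n → Set
AtomBelow N (prop k) = k < N
AtomBelow N _        = ⊤

AtomsBelow₀ : ℕ → Form0 n → Set
AtomsBelow₀ N (atom₀ p) = AtomBelow N p
AtomsBelow₀ N (¬₀ α)    = AtomsBelow₀ N α
AtomsBelow₀ N (α ∧₀ β)  = AtomsBelow₀ N α × AtomsBelow₀ N β
AtomsBelow₀ N (△ i α)   = AtomsBelow₀ N α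

AtomsBelow : ℕ → Form n → Set
AtomsBelow N (atom p)    = AtomBelow N p
AtomsBelow N (tri i α)   = AtomsBelow₀ N α
AtomsBelow N (¬' φ)      = AtomsBelow N φ
AtomsBelow N (φ ∧' ψ)    = AtomsBelow N φ × AtomsBelow N ψ
AtomsBelow N (□ i φ)     = AtomsBelow N φ
AtomsBelow N (mod o i φ) = AtomsBelow N φ

atomBound : Atm n → ℕ
atomBound (prop k) = suc k
atomBound _        = 0

bound₀ : Form0 n → ℕ
bound₀ (atom₀ p) = atomBound p
bound₀ (¬₀ α)    = bound₀ α
bound₀ (α ∧₀ β)  = bound₀ α ⊔ bound₀ β
bound₀ (△ i α)   = bound₀ α

bound : Form n → ℕ
bound (atom p)    = atomBound p
bound (tri i α)   = bound₀ α
bound (¬' φ)      = bound φ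
bound (φ ∧' ψ)    = bound φ ⊔ bound ψ
bound (□ i φ)     = bound φ
bound (mod o i φ) = bound φ

atomBelow-bound : ∀ (p : Atm n) → atomBound p ≤ N → AtomBelow N p
atomBelow-bound (good i) _   = tt
atomBelow-bound (bad i)  _   = tt
atomBelow-bound (prop k) k<N = k<N

atomsBelow₀-bound : ∀ (α : Form0 n) → bound₀ α ≤ N → AtomsBelow₀ N α
atomsBelow₀-bound (atom₀ p) le = atomBelow-bound p le
atomsBelow₀-bound (¬₀ α)    le = atomsBelow₀-bound α le
atomsBelow₀-bound (α ∧₀ β)  le =
  atomsBelow₀-bound α (≤-trans (m≤m⊔n _ _) le) , atomsBelow₀-bound β (≤-trans (m≤n⊔m _ _) le)
atomsBelow₀-bound (△ i α)   le = atomsBelow₀-bound α le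

atomsBelow-bound : ∀ (φ : Form n) → bound φ ≤ N → AtomsBelow N φ
atomsBelow-bound (atom p)    le = atomBelow-bound p le
atomsBelow-bound (tri i α)   le = atomsBelow₀-bound α le
atomsBelow-bound (¬' φ)      le = atomsBelow-bound φ le
atomsBelow-bound (φ ∧' ψ)    le =
  atomsBelow-bound φ (≤-trans (m≤m⊔n _ _) le) , atomsBelow-bound ψ (≤-trans (m≤n⊔m _ _) le)
atomsBelow-bound (□ i φ)     le = atomsBelow-bound φ le
atomsBelow-bound (mod o i φ) le = atomsBelow-bound φ le

⊥₁ : Set₁
⊥₁ = Lift (lsuc 0ℓ) ⊥

private variable
  𝕌 : State {n} → Set₁
  S : State {n}

Appraised : Atm n → Fin n → State → State → Set
Appraised ℓ i S S′ = Σ[ α ∈ Form0 _ ] B S i (α ⇒₀ atom₀ ℓ) × S′ ⊨₀ α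

⇒-intro : {X Y : Set₁} → (X → Y) → X × (Y → ⊥₁) → ⊥₁
⇒-intro f (x , ¬y) = ¬y (f x)

T-not-⇔ : ∀ {b} {X : Set₁} → T b ⇔ X → T (not b) ⇔ (X → ⊥₁)
T-not-⇔ {true}  b⇔X = mk⇔ (λ ()) (λ ¬X → lower (¬X (to b⇔X _)))
T-not-⇔ {false} b⇔X = mk⇔ (λ _ x → ⊥-elim (from b⇔X x)) _

ι-sat : ∀ α → Sat 𝕌 S (ι α) ⇔ S ⊨₀ α
ι-sat (atom₀ p) = mk⇔ lower lift
ι-sat (¬₀ α)    = →-cong-⇔ (ι-sat α) (mk⇔ lower lift)
ι-sat (α ∧₀ β)  = ι-sat α ×-⇔ ι-sat β
ι-sat (△ i α)   = mk⇔ lower lift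

Sat-mod-union : ∀ o → Sat 𝕌 S (mod o i φ) → Sat 𝕌 S (mod o i χ) →
                (∀ S′ → 𝕌 S′ → Sat 𝕌 S′ ψ → Sat 𝕌 S′ φ ⊎ Sat 𝕌 S′ χ) → Sat 𝕌 S (mod o i ψ)
Sat-mod-union opA     ⊚φ ⊚χ cover S′ u s   = [ ⊚φ S′ u , ⊚χ S′ u ]′ (cover S′ u s)
Sat-mod-union opR     ⊚φ ⊚χ cover S′ u s   = [ ⊚φ S′ u , ⊚χ S′ u ]′ (cover S′ u s)
Sat-mod-union opAreal ⊚φ ⊚χ cover S′ u s e = [ (λ sφ → ⊚φ S′ u sφ e) , (λ sχ → ⊚χ S′ u sχ e) ]′ (cover S′ u s)
Sat-mod-union opRreal ⊚φ ⊚χ cover S′ u s e = [ (λ sφ → ⊚φ S′ u sφ e) , (λ sχ → ⊚χ S′ u sχ e) ]′ (cover S′ u s)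

Sat-mod-antitone : ∀ o → (∀ S′ → 𝕌 S′ → Sat 𝕌 S′ φ → Sat 𝕌 S′ ψ) →
                   Sat 𝕌 S (mod o i ψ) → Sat 𝕌 S (mod o i φ)
Sat-mod-antitone o φ⊆ψ ⊚ψ = Sat-mod-union o ⊚ψ ⊚ψ λ S′ u s → inj₁ (φ⊆ψ S′ u s)

Sat-mod-vacuous : ∀ o → (∀ S′ → 𝕌 S′ → ¬ Sat 𝕌 S′ φ) → Sat 𝕌 S (mod o i φ)
Sat-mod-vacuous opA     none S′ u s   = ⊥-elim (none S′ u s)
Sat-mod-vacuous opR     none S′ u s   = ⊥-elim (none S′ u s)
Sat-mod-vacuous opAreal none S′ u s _ = ⊥-elim (none S′ u s)
Sat-mod-vacuous opRreal none S′ u s _ = ⊥-elim (none S′ u s)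

-- Classical metatheory

module WithExcludedMiddle (em : ∀ {ℓ} → ExcludedMiddle ℓ) where

  ⇒-elim : {X Y : Set₁} → (X × (Y → ⊥₁) → ⊥₁) → X → Y
  ⇒-elim x⇒y x = em⇒dne em λ ¬y → lower (x⇒y (x , lift ∘ ¬y))

  pick : Dec (Σ[ φ ∈ Form n ] code φ ≡ k) → Form n
  pick (yes (φ , _)) = φ
  pick (no _)        = falsum

  enumerate : ℕ → Form n
  enumerate k = pick {k = k} em

  enumerate-code : ∀ (φ : Form n) → enumerate (code φ) ≡ φ
  enumerate-code φ = pick-code em
    where
    pick-code : (d : Dec (Σ[ ψ ∈ Form _ ] code ψ ≡ code φ)) → pick d ≡ φ
    pick-code (yes (ψ , e)) = code-injective e
    pick-code (no ∄ψ)       = ⊥-elim (∄ψ (φ , refl))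

  record Extension (Δ : Pred (Form n) 0ℓ) (y : Form n) : Set₁ where
    field
      Δ′         : Pred (Form n) 0ℓ
      consistent : Consistent Δ′
      ⊇Δ         : Δ ⊆ Δ′
      decides    : Δ′ y ⊎ Δ′ (¬' y)

  extend : Consistent Δ → ∀ y → Extension Δ y
  extend {Δ = Δ} Δ-consistent y with em {P = Consistent (Δ ∪ ｛ y ｝)}
  ... | yes c = record { Δ′ = Δ ∪ ｛ y ｝ ; consistent = c ; ⊇Δ = inj₁ ; decides = inj₁ (inj₂ refl) }
  ... | no ¬c = record
    { Δ′ = Δ ∪ ｛ ¬' y ｝ ; consistent = ¬-extension-consistent Δ-consistent ¬c
    ; ⊇Δ = inj₁ ; decides = inj₂ (inj₂ refl)
    }

  module Lindenbaum {n : ℕ} {Γ : Pred (Form n) 0ℓ} (Γ-consistent : Consistent Γ) where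
    stage : ℕ → Σ (Pred (Form n) 0ℓ) Consistent
    step  : ∀ k → Extension (proj₁ (stage k)) (enumerate k)
    stage zero    = Γ , Γ-consistent
    stage (suc k) = Extension.Δ′ (step k) , Extension.consistent (step k)
    step k = extend (proj₂ (stage k)) (enumerate k)

    Stage : ℕ → Pred (Form n) 0ℓ
    Stage k = proj₁ (stage k)

    Stage-mono : k ≤′ m → Stage k ⊆ Stage m
    Stage-mono ≤′-refl        a∈ = a∈
    Stage-mono (≤′-step k≤′m) a∈ = Extension.⊇Δ (step _) (Stage-mono k≤′m a∈)

    Limit : Pred (Form n) 0ℓ
    Limit a = ∃[ k ] Stage k a

    compact : Limit ⊩ a → ∃[ k ] Stage k ⊩ a
    compact (hyp (k , a∈)) = k , hyp a∈
    compact (thm ⊢a)       = 0 , thm ⊢a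
    compact (mp⊩ d e) with compact d | compact e
    ... | k , d′ | m , e′ = k ⊔ m , mp⊩ (⊩-mono (Stage-mono (≤⇒≤′ (m≤m⊔n k m))) d′)
                                        (⊩-mono (Stage-mono (≤⇒≤′ (m≤n⊔m k m))) e′)

    decides : ∀ φ → Stage (suc (code φ)) φ ⊎ Stage (suc (code φ)) (¬' φ)
    decides φ = subst (λ y → Stage (suc (code φ)) y ⊎ Stage (suc (code φ)) (¬' y))
                      (enumerate-code φ) (Extension.decides (step (code φ)))

    limit : MCS n
    limit = record
      { Member     = Limit
      ; consistent = λ d → let (k , d′) = compact d in proj₂ (stage k) d′
      ; decisive   = λ φ → Sum.map (suc (code φ) ,_) (suc (code φ) ,_) (decides φ)
      }

  lindenbaum : Consistent Γ → Σ[ w ∈ MCS n ] Γ ⊆ Member w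
  lindenbaum Γ-consistent = limit , (0 ,_)
    where open Lindenbaum Γ-consistent

  theory-witness : IsTheory F → ¬ F (x ⇒ falsum) → Σ[ v ∈ MCS n ] x ∈ v × F ⊆ Member v
  theory-witness F-theory x⇒⊥∉F =
    let (v , F∪x⊆v) = lindenbaum (IsTheory.extension-consistent F-theory x⇒⊥∉F)
    in v , F∪x⊆v (inj₂ refl) , F∪x⊆v ∘ inj₁

  □-witness : ∀ (w : MCS n) i → ¬ □ i φ ∈ w → Σ[ v ∈ MCS n ] ¬' φ ∈ v × Access i w v
  □-witness {φ = φ} w i □φ∉w = theory-witness (□-theory w i) λ □¬φ⇒⊥∈w → □φ∉w
    (IsTheory.∈-⊢ (□-theory w i) □¬φ⇒⊥∈w (tautology ((~ x₀ ⊃ x₁ & ~ x₁) ⊃ x₀) (φ ∷ atom (prop 0) ∷ [])))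

  mod-witness : ∀ (w : MCS n) o i → ¬ mod o i φ ∈ w →
                Σ[ v ∈ MCS n ] φ ∈ v × (λ a → mod o i (¬' a) ∈ w) ⊆ Member v
  mod-witness {φ = φ} w o i ⊚φ∉w = theory-witness (mod¬-theory w o i) λ ⊚¬φ⇒⊥∈w → ⊚φ∉w
    (∈-⊢ w ⊚¬φ⇒⊥∈w (mod-antitone o i (tautology (x₀ ⊃ ~ (x₀ ⊃ x₁ & ~ x₁)) (φ ∷ atom (prop 0) ∷ []))))

  module CanonicalModel {n : ℕ} (N : ℕ) where
    marker : Atm n
    marker = prop N

    ⌜_⌝ : Form n → Atm n
    ⌜ χ ⌝ = prop (N + suc (code χ))

    data Val (w : MCS n) : Bool → Atm n → Set where
      base   : AtomBelow N p → atom p ∈ w → Val w h p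
      marked : Val w true marker
      holds  : χ ∈ w → Val w h ⌜ χ ⌝

    data Belief (w : MCS n) (i : Fin n) : Form0 n → Set where
      base       : AtomsBelow₀ N α → tri i α ∈ w → Belief w i α
      known      : □ i χ ∈ w → Belief w i (atom₀ ⌜ χ ⌝)
      unmarked   : Belief w i (¬₀ atom₀ marker)
      appraised  : Valence i o o′ ℓ → mod o i χ ∈ w → Belief w i (atom₀ ⌜ χ ⌝ ⇒₀ atom₀ ℓ)
      appraisedʳ : Valence i o o′ ℓ → mod o′ i χ ∈ w →
                   Belief w i ((atom₀ ⌜ χ ⌝ ∧₀ (¬₀ atom₀ marker)) ⇒₀ atom₀ ℓ)

    canonical : MCS n → Bool → State
    canonical w h = record { B = Belief w ; V = Val w h }

    U : State → Set₁
    U S = ∃₂ λ w h → canonical w h ≡ S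

    marked-only : Val w h (prop k) → k ≡ N → h ≡ true
    marked-only (base k<N _) refl = ⊥-elim (n≮n N k<N)
    marked-only marked       _    = refl
    marked-only (holds _)    e    = ⊥-elim (m+1+n≢m N e)

    holds-only : Val w h (prop k) → k ≡ N + suc (code χ) → χ ∈ w
    holds-only (base k<N _)        refl = ⊥-elim (m+n≮m N _ k<N)
    holds-only marked              e    = ⊥-elim (m+1+n≢m N (sym e))
    holds-only {w = w} (holds χ∈w) e    =
      subst (_∈ w) (code-injective (suc-injective (+-cancelˡ-≡ N _ _ e))) χ∈w

    unmarked-false : ¬ Val w h marker → h ≡ false
    unmarked-false {h = false} _       = refl
    unmarked-false {h = true}  ¬marked = ⊥-elim (¬marked marked)

    Val-base : AtomBelow N p → Val w h p → atom p ∈ w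
    Val-base _     (base _ p∈w) = p∈w
    Val-base below marked       = ⊥-elim (n≮n N below)
    Val-base below (holds _)    = ⊥-elim (m+n≮m N _ below)

    Belief-base : Belief w i α → AtomsBelow₀ N α → tri i α ∈ w
    Belief-base (base _ tri∈w)   _                 = tri∈w
    Belief-base (known _)        below             = ⊥-elim (m+n≮m N _ below)
    Belief-base unmarked         below             = ⊥-elim (n≮n N below)
    Belief-base (appraised _ _)  (below , _)       = ⊥-elim (m+n≮m N _ below)
    Belief-base (appraisedʳ _ _) ((below , _) , _) = ⊥-elim (m+n≮m N _ below)

    truth₀ : ∀ {w h} α → AtomsBelow₀ N α → (canonical w h ⊨₀ α) ⇔ ι α ∈ w
    truth₀     (atom₀ p) below             = mk⇔ (Val-base below) (base below)
    truth₀ {w} (¬₀ α)    below             = ⇔-trans (¬-cong-⇔ (truth₀ α below)) (⇔-sym (¬-∈ w))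
    truth₀ {w} (α ∧₀ β)  (below₁ , below₂) = ⇔-trans (truth₀ α below₁ ×-⇔ truth₀ β below₂) (∧-∈ w)
    truth₀     (△ i α)   below             = mk⇔ (λ b → Belief-base b below) (base below)

    valence-below : Valence i o o′ ℓ → AtomBelow N ℓ
    valence-below attraction = tt
    valence-below repulsion  = tt

    ⇒-holds : Valence i o o′ ℓ → (χ ⇒ atom ℓ) ∈ v → canonical v h ⊨₀ (atom₀ ⌜ χ ⌝ ⇒₀ atom₀ ℓ)
    ⇒-holds {v = v} val χ⇒ℓ∈v (⌜χ⌝ , ¬ℓ) =
      ¬ℓ (base (valence-below val) (mp∈ v (holds-only ⌜χ⌝ refl) χ⇒ℓ∈v))

    ℰ⇒Access : ℰ i (canonical w h) (canonical v h′) → h′ ≡ false × Access i w v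
    ℰ⇒Access e = unmarked-false (e _ unmarked) , λ □χ∈w → holds-only (e _ (known □χ∈w)) refl

    Access⇒ℰ : Access i w v → ℰ i (canonical w h) (canonical v false)
    Access⇒ℰ {w = w} acc α (base below tri∈w) = from (truth₀ α below) (acc (∈-⊢ w tri∈w (A3 _ α)))
    Access⇒ℰ acc _ (known □χ∈w) = holds (acc □χ∈w)
    Access⇒ℰ acc _ unmarked     = λ x → case marked-only x refl of λ ()
    Access⇒ℰ {w = w} acc _ (appraised val ⊚χ∈w) =
      ⇒-holds val (acc (∈-⊢ w (∈-⊢ w ⊚χ∈w (plain⇒real val _)) (real⇒□ val _)))
    Access⇒ℰ {w = w} acc _ (appraisedʳ val ⊚χ∈w) = λ ((⌜χ⌝ , _) , ¬ℓ) →
      ⇒-holds val (acc (∈-⊢ w ⊚χ∈w (real⇒□ val _))) (⌜χ⌝ , ¬ℓ)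

    appraised-plain : Valence i o o′ ℓ → mod o i χ ∈ w → χ ∈ v →
                      Appraised ℓ i (canonical w h) (canonical v h′)
    appraised-plain {χ = χ} val ⊚χ∈w χ∈v = atom₀ ⌜ χ ⌝ , appraised val ⊚χ∈w , holds χ∈v

    appraised-real : Valence i o o′ ℓ → mod o′ i χ ∈ w → χ ∈ v → h′ ≡ false →
                     Appraised ℓ i (canonical w h) (canonical v h′)
    appraised-real {χ = χ} val ⊚χ∈w χ∈v refl = (atom₀ ⌜ χ ⌝ ∧₀ (¬₀ atom₀ marker)) ,
      appraisedʳ val ⊚χ∈w , (holds χ∈v , λ x → case marked-only x refl of λ ())

    Appraised⇒∈ : Valence i o o′ ℓ → Appraised ℓ i (canonical w h) (canonical v h′) →
                  ∃[ χ ] χ ∈ v × (mod o i χ ∈ w ⊎ (h′ ≡ false × mod o′ i χ ∈ w))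
    Appraised⇒∈ {w = w} val (α , base (below , _) tri∈w , sat) =
      ι α , to (truth₀ α below) sat , inj₁ (∈-⊢ w tri∈w (tri⇒plain val α))
    Appraised⇒∈ attraction (_ , appraised attraction ⊚χ∈w , sat) = _ , holds-only sat refl , inj₁ ⊚χ∈w
    Appraised⇒∈ repulsion  (_ , appraised repulsion ⊚χ∈w , sat)  = _ , holds-only sat refl , inj₁ ⊚χ∈w
    Appraised⇒∈ attraction (_ , appraisedʳ attraction ⊚χ∈w , (sat , ¬marked)) =
      _ , holds-only sat refl , inj₂ (unmarked-false ¬marked , ⊚χ∈w)
    Appraised⇒∈ repulsion  (_ , appraisedʳ repulsion ⊚χ∈w , (sat , ¬marked)) =
      _ , holds-only sat refl , inj₂ (unmarked-false ¬marked , ⊚χ∈w)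

    Truth : Form n → Set₁
    Truth φ = ∀ w h → Sat U (canonical w h) φ ⇔ φ ∈ w

    truth-□ : ∀ i → Truth φ → Truth (□ i φ)
    truth-□ {φ} i IH w h = mk⇔ sat⇒∈ ∈⇒sat
      where
      ∈⇒sat : □ i φ ∈ w → Sat U (canonical w h) (□ i φ)
      ∈⇒sat □φ∈w _ (v , h′ , refl) e = from (IH v h′) (proj₂ (ℰ⇒Access {h = h} {v = v} {h′} e) □φ∈w)

      sat⇒∈ : Sat U (canonical w h) (□ i φ) → □ i φ ∈ w
      sat⇒∈ H = ∈-stable w λ □φ∉w →
        let (v , ¬φ∈v , acc) = □-witness w i □φ∉w
        in to (¬-∈ v) ¬φ∈v (to (IH v false) (H _ (v , false , refl) (Access⇒ℰ {v = v} {h = h} acc)))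

    truth-plain : Valence i o o′ ℓ → Truth φ → ∀ w h →
                  (∀ S′ → U S′ → Sat U S′ φ → Appraised ℓ i (canonical w h) S′) ⇔ mod o i φ ∈ w
    truth-plain {i} {o} {ℓ = ℓ} {φ} val IH w h = mk⇔ sat⇒∈ ∈⇒sat
      where
      ∈⇒sat : mod o i φ ∈ w → ∀ S′ → U S′ → Sat U S′ φ → Appraised ℓ i (canonical w h) S′
      ∈⇒sat ⊚φ∈w _ (v , h′ , refl) s = appraised-plain {h = h} {h′ = h′} val ⊚φ∈w (to (IH v h′) s)

      -- The witness is marked, so that no realistic appraisal reaches it.
      sat⇒∈ : (∀ S′ → U S′ → Sat U S′ φ → Appraised ℓ i (canonical w h) S′) → mod o i φ ∈ w
      sat⇒∈ H = ∈-stable w λ ⊚φ∉w →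
        let (v , φ∈v , ⊆v) = mod-witness w o i ⊚φ∉w
            reach = H _ (v , true , refl) (from (IH v true) φ∈v)
        in case Appraised⇒∈ {h = h} {v = v} {h′ = true} val reach of λ where
             (_ , χ∈v , inj₁ ⊚χ∈w)   → mod-excludes w v ⊆v ⊚χ∈w χ∈v
             (_ , _ , inj₂ (() , _))

    truth-real : Valence i o o′ ℓ → Truth φ → ∀ w h →
                 (∀ S′ → U S′ → Sat U S′ φ → ℰ i (canonical w h) S′ → Appraised ℓ i (canonical w h) S′)
                 ⇔ mod o′ i φ ∈ w
    truth-real {i} {o′ = o′} {ℓ} {φ} val IH w h = mk⇔ sat⇒∈ ∈⇒sat
      where
      ∈⇒sat : mod o′ i φ ∈ w →
              ∀ S′ → U S′ → Sat U S′ φ → ℰ i (canonical w h) S′ → Appraised ℓ i (canonical w h) S′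
      ∈⇒sat ⊚φ∈w _ (v , h′ , refl) s e =
        appraised-real {h = h} val ⊚φ∈w (to (IH v h′) s) (proj₁ (ℰ⇒Access {h = h} {v = v} {h′} e))

      sat⇒∈ : (∀ S′ → U S′ → Sat U S′ φ → ℰ i (canonical w h) S′ → Appraised ℓ i (canonical w h) S′) →
              mod o′ i φ ∈ w
      sat⇒∈ H = ∈-stable w λ ⊚φ∉w →
        let (v , φ∈v , ⊆v) = mod-witness w o′ i ⊚φ∉w
            reach = H _ (v , false , refl) (from (IH v false) φ∈v)
                      (Access⇒ℰ {v = v} {h = h} (□-cone⊆real-cone w v val ⊆v))
        in case Appraised⇒∈ {h = h} {v = v} {h′ = false} val reach of λ where
             (χ , χ∈v , inj₁ ⊚χ∈w)       → mod-excludes w v ⊆v (∈-⊢ w ⊚χ∈w (plain⇒real val χ)) χ∈v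
             (_ , χ∈v , inj₂ (_ , ⊚χ∈w)) → mod-excludes w v ⊆v ⊚χ∈w χ∈v

    truth : ∀ φ → AtomsBelow N φ → Truth φ
    truth (atom p)    below _ _ = mk⇔ (Val-base below ∘ lower) (lift ∘ base below)
    truth (tri i α)   below _ _ = mk⇔ (λ b → Belief-base (lower b) below) (lift ∘ base below)
    truth (¬' φ)      below w h = ⇔-trans (→-cong-⇔ (truth φ below w h) (mk⇔ lower lift)) (⇔-sym (¬-∈ w))
    truth (φ ∧' ψ) (below₁ , below₂) w h = ⇔-trans (truth φ below₁ w h ×-⇔ truth ψ below₂ w h) (∧-∈ w)
    truth (□ i φ)           below = truth-□ i (truth φ below)
    truth (mod opA i φ)     below = truth-plain attraction (truth φ below)
    truth (mod opR i φ)     below = truth-plain repulsion (truth φ below)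
    truth (mod opAreal i φ) below = truth-real attraction (truth φ below)
    truth (mod opRreal i φ) below = truth-real repulsion (truth φ below)

  completeness : ⊨ φ → ⊢ φ
  completeness {n} {φ} ⊨φ = decidable-stable em λ ⊬φ → refute (theory-witness ⊢-theory λ ⊢¬φ⇒⊥ →
    ⊬φ (mp ⊢¬φ⇒⊥ (tautology ((~ x₀ ⊃ x₁ & ~ x₁) ⊃ x₀) (φ ∷ atom (prop 0) ∷ []))))
    where
    open CanonicalModel (bound φ)

    refute : (Σ[ w ∈ MCS n ] ¬' φ ∈ w × ⊢_ ⊆ Member w) → ⊥
    refute (w , ¬φ∈w , _) = to (¬-∈ w) ¬φ∈w
      (to (truth φ (atomsBelow-bound φ ≤-refl) w false) (⊨φ U (canonical w false) (w , false , refl)))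

  module Soundness {n : ℕ} (U : State {n} → Set₁) where
    truthValue : State → Form n → Bool
    truthValue S ψ = isYes (em {P = Sat U S ψ})

    truthValue-correct : ∀ S φ → T (evalB (truthValue S) φ) ⇔ Sat U S φ
    truthValue-correct S (atom p)    = mk⇔ toWitness fromWitness
    truthValue-correct S (tri i α)   = mk⇔ toWitness fromWitness
    truthValue-correct S (¬' φ)      = T-not-⇔ (truthValue-correct S φ)
    truthValue-correct S (φ ∧' ψ)    = ⇔-trans T-∧ (truthValue-correct S φ ×-⇔ truthValue-correct S ψ)
    truthValue-correct S (□ i φ)     = mk⇔ toWitness fromWitness
    truthValue-correct S (mod o i φ) = mk⇔ toWitness fromWitness

    real⇒□-sat : (∀ S′ → U S′ → Sat U S′ φ → ℰ i S S′ → Appraised ℓ i S S′) → Sat U S (□ i (φ ⇒ atom ℓ))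
    real⇒□-sat H S′ u e = ⇒-intro λ sφ → lift (em⇒dne em λ ¬ℓ →
      let (α , α⇒ℓ∈B , sα) = H S′ u sφ e in e _ α⇒ℓ∈B (sα , ¬ℓ))

    sound : ⊢ φ → ∀ S → Sat U S φ
    sound (taut t)     S = to (truthValue-correct S _) (from T-≡ (t (truthValue S)))
    sound (mp d e)     S = ⇒-elim (sound e S) (sound d S)
    sound (A1 i φ ψ)   S = ⇒-intro λ (□φ , □φ⇒ψ) S′ u e → ⇒-elim (□φ⇒ψ S′ u e) (□φ S′ u e)
    sound (A2 o i φ ψ) S = ⇒-intro λ (⊚φ , ⊚¬φ∧ψ) → Sat-mod-union o ⊚φ ⊚¬φ∧ψ λ S′ _ sψ →
      Sum.map₂ (λ ¬sφ → lift ∘ ¬sφ , sψ) (toSum (em {P = Sat U S′ φ}))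
    sound (A3 i α)     S = ⇒-intro λ (lift α∈B) S′ _ e → from (ι-sat α) (e α α∈B)
    sound (A4 i α)     S = ⇒-intro λ (lift α⇒good∈B) S′ _ s → α , α⇒good∈B , to (ι-sat α) s
    sound (A5 i α)     S = ⇒-intro λ (lift α⇒bad∈B) S′ _ s → α , α⇒bad∈B , to (ι-sat α) s
    sound (A6 i φ)     S = ⇒-intro λ Aφ S′ u s _ → Aφ S′ u s
    sound (A7 i φ)     S = ⇒-intro λ Rφ S′ u s _ → Rφ S′ u s
    sound (A8 i φ)     S = ⇒-intro λ □φ S′ u ¬sφ e → ⊥-elim (lower (¬sφ (□φ S′ u e)))
    sound (A9 i φ)     S = ⇒-intro λ □φ S′ u ¬sφ e → ⊥-elim (lower (¬sφ (□φ S′ u e)))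
    sound (A10 i φ)    S = ⇒-intro (real⇒□-sat {S = S})
    sound (A11 i φ)    S = ⇒-intro (real⇒□-sat {S = S})
    sound (R1 i d)     S S′ _ _ = sound d S′
    sound (R2 o i d)   S = Sat-mod-vacuous o λ S′ _ ¬sφ → lower (¬sφ (sound d S′))
    sound (R3 o i d)   S = ⇒-intro (Sat-mod-antitone o λ S′ _ → ⇒-elim (proj₂ (sound d S′))) ,
                           ⇒-intro (Sat-mod-antitone o λ S′ _ → ⇒-elim (proj₁ (sound d S′)))

  soundness : ⊢ φ → ⊨ φ
  soundness d U S _ = Soundness.sound U d S

theorem2 : ({ℓ : Level} → ExcludedMiddle ℓ) →
    (n : ℕ) (φ : Form n) → ((⊢ φ) → (⊨ φ)) × ((⊨ φ) → (⊢ φ))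
theorem2 em n φ = soundness , completeness
  where open WithExcludedMiddle em
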